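{- Let $n=2^s$, $q=2^r$ ($s,r$ positive integers), $N=|SL(n,q)|$, and $g_1,\dots,g_N$ a fixed ordering of $SL(n,q)$. The map $\mathbb{F}_q\to C^\perp(SL(n,q))$, $a\mapsto c(a)=(tr(aTr(g_1)),\dots,tr(aTr(g_N)))$, is an $\mathbb{F}_2$-linear isomorphism.
   Context: $tr(x)=x+x^2+\cdots+x^{2^{r-1}}$ is the absolute trace $\mathbb{F}_q\to\mathbb{F}_2$; $Tr$ is the matrix trace. With $v=(Tr(g_1),\dots,Tr(g_N))$, $C(SL(n,q))=\{u\in\mathbb{F}_2^N:u\cdot v=0\}$ (dot product in $\mathbb{F}_q$) and $C^\perp(SL(n,q))$ is its dual binary code. -}

module Defs where

open import Level using (0ℓ)
open import Data.Nat as ℕ using (ℕ; zero; suc)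
open import Data.Fin using (Fin; zero; suc; toℕ)
open import Data.Bool using (Bool; true; false; _xor_; _∧_; if_then_else_)
open import Data.Vec using (Vec; []; _∷_; lookup; removeAt; map; zipWith; tabulate; foldr′)
open import Data.Product using (Σ; ∃; _×_; _,_)
open import Relation.Nullary using (¬_; does)
open import Relation.Binary.PropositionalEquality using (_≡_)
open import Relation.Binary.Definitions using (DecidableEquality)
open import Algebra.Structures using (IsCommutativeRing)
open import Function.Bundles using (_⤖_)

record FiniteField (q : ℕ) : Set₁ where
  infixl 6 _+_
  infixl 7 _*_
  field
    Carrier : Set
    _+_ _*_ : Carrier → Carrier → Carrier
    -_ : Carrier → Carrier
    0# 1# : Carrier
    isCommutativeRing : IsCommutativeRing _≡_ _+_ _*_ -_ 0# 1#
    0≢1 : ¬ (0# ≡ 1#)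
    inverse : ∀ x → ¬ (x ≡ 0#) → ∃ λ y → x * y ≡ 1#
    _≟_ : DecidableEquality Carrier
    card : Fin q ⤖ Carrier

module _ {q : ℕ} (K : FiniteField q) where
  open FiniteField K

  -- n × n matrices over K (list of rows)
  Matrix : ℕ → Set
  Matrix n = Vec (Vec Carrier n) n

  Σ[_] : ∀ {m} → Vec Carrier m → Carrier
  Σ[ v ] = foldr′ _+_ 0# v

  pow : Carrier → ℕ → Carrier
  pow x zero = 1#
  pow x (suc k) = x * pow x k

  signed : ℕ → Carrier → Carrier
  signed zero x = x
  signed (suc j) x = - signed j x

  det : ∀ n → Matrix n → Carrier
  det zero [] = 1#
  det (suc n) (row ∷ rows) =
    Σ[ tabulate (λ j → signed (toℕ j) (lookup row j * det n (map (λ r → removeAt r j) rows))) ]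

  Tr : ∀ {n} → Matrix n → Carrier
  Tr {n} g = Σ[ tabulate (λ i → lookup (lookup g i) i) ]

  IsSL : ∀ n → Matrix n → Set
  IsSL n g = det n g ≡ 1#

  trK : ℕ → Carrier → Carrier
  trK r x = Σ[ tabulate {n = r} (λ k → pow x (2 ℕ.^ toℕ k)) ]

  -- tr as a map to F₂ = Bool (true = 1)
  trB : ℕ → Carrier → Bool
  trB r x = does (trK r x ≟ 1#)

  emb : Bool → Carrier
  emb true = 1#
  emb false = 0#

  -- C(SL(n,q)) = { u ∈ F₂^N : Σ u_i Tr(g_i) = 0 in K }, for the ordering gs
  InC : ∀ {n N} → Vec (Matrix n) N → Vec Bool N → Set
  InC gs u = Σ[ zipWith (λ ui g → emb ui * Tr g) u gs ] ≡ 0#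

  dot₂ : ∀ {N} → Vec Bool N → Vec Bool N → Bool
  dot₂ u w = foldr′ _xor_ false (zipWith _∧_ u w)

  InC⊥ : ∀ {n N} → Vec (Matrix n) N → Vec Bool N → Set
  InC⊥ {N = N} gs w = ∀ (u : Vec Bool N) → InC gs u → dot₂ u w ≡ false

  cw : ∀ {n N} → ℕ → Vec (Matrix n) N → Carrier → Vec Bool N
  cw r gs a = map (λ g → trB r (a * Tr g)) gs

-- In characteristic 2 the absolute trace tr is additive, satisfies tr(x)² = tr(x) (since x^q = x),
-- hence takes values in 𝔽₂ ⊆ K, and it is not identically zero, being a polynomial of degree
-- 2^(r-1) < q.  So a ↦ (x ↦ tr(a x)) is an injective 𝔽₂-linear map into the additive maps K → 𝔽₂,
-- and it is onto them by a character-sum count.  As n = 2^s is even, every t ∈ K is the trace of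
-- some matrix of SL(n, q) (a block [[t, 1], [1, 0]] beside an identity block of even size), so c(a)
-- records x ↦ tr(a x) at every point.  Conversely a word of C^⊥ satisfies every 𝔽₂-relation
-- among the traces Tr(g_i): its value at g_i depends only on Tr(g_i), additively, and is therefore
-- tr(a Tr(g_i)) for a unique a.
module Submission where

open import Defs
open import Level using (0ℓ)
open import Data.Nat as ℕ using (ℕ; zero; suc; _≤_; _<_; z≤n; s≤s; _^_)
import Data.Nat.Properties as ℕ
open import Data.Nat.Tactic.RingSolver using (solve-∀)
open import Data.Fin as Fin using (Fin; zero; suc; toℕ)
import Data.Fin.Properties as Fin
open import Data.Vec as Vec using (Vec; []; _∷_; lookup; removeAt; map; replicate; tabulate; zipWith)
import Data.Vec.Properties as Vec
open import Data.Bool using (Bool; true; false; _∧_; _xor_; if_then_else_)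
import Data.Bool.Properties as Bool
open import Data.Integer as ℤ using (ℤ)
import Data.Integer.Properties as ℤ
open import Data.Product using (∃; _×_; _,_; proj₁; proj₂)
open import Data.Sum as Sum using (_⊎_; inj₁; inj₂; [_,_]; [_,_]′)
open import Data.Empty using (⊥-elim)
open import Relation.Nullary using (¬_; Dec; yes; no; does)
open import Relation.Nullary.Decidable using (dec-true; dec-false)
open import Relation.Binary.PropositionalEquality
  using (_≡_; _≢_; _≗_; refl; sym; trans; cong; cong₂; subst; module ≡-Reasoning)
open import Function.Base using (_∘_; id)
open import Function.Bundles using (_↔_; Inverse; Bijection; mk↔ₛ′)
open import Function.Definitions using (Injective)
open import Function.Properties.Bijection using (⤖⇒↔)
open import Function.Construct.Composition using (_↔-∘_)
open import Function.Construct.Symmetry using (↔-sym)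
open import Algebra.Bundles using (CommutativeRing; CommutativeMonoid; Semiring)
import Algebra.Properties.CommutativeMonoid.Sum (Semiring.+-commutativeMonoid ℤ.+-*-semiring) as ℤSum
open import Algebra.Properties.CommutativeSemigroup (CommutativeRing.+-commutativeSemigroup Bool.xor-∧-commutativeRing)
  using () renaming (interchange to xor-interchange)

≢⇒xor≡true : ∀ {a b} → a ≢ b → a xor b ≡ true
≢⇒xor≡true {false} {false} a≢b = ⊥-elim (a≢b refl)
≢⇒xor≡true {false} {true}  _   = refl
≢⇒xor≡true {true}  {false} _   = refl
≢⇒xor≡true {true}  {true}  a≢b = ⊥-elim (a≢b refl)

xor≡false⇒≡ : ∀ {a b} → a xor b ≡ false → a ≡ b
xor≡false⇒≡ {false} {false} _ = refl
xor≡false⇒≡ {true}  {true}  _ = refl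

sign : Bool → ℤ
sign false = ℤ.1ℤ
sign true  = ℤ.-1ℤ

sign-xor : ∀ a b → sign (a xor b) ≡ sign a ℤ.* sign b
sign-xor false false = refl
sign-xor false true  = refl
sign-xor true  false = refl
sign-xor true  true  = refl

sign-xor-true : ∀ a → sign (a xor true) ≡ ℤ.- sign a
sign-xor-true false = refl
sign-xor-true true  = refl

∑-neg : ∀ {n} (g : Fin n → ℤ) → ℤSum.sum (λ i → ℤ.- g i) ≡ ℤ.- ℤSum.sum g
∑-neg {zero}  g = refl
∑-neg {suc n} g = trans (cong (λ s → ℤ.- g zero ℤ.+ s) (∑-neg (g ∘ suc))) (sym (ℤ.neg-distrib-+ (g zero) _))

∑-ones : ∀ n → ℤSum.sum {n} (λ _ → ℤ.1ℤ) ≡ ℤ.+ n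
∑-ones zero    = refl
∑-ones (suc n) = cong (λ s → ℤ.1ℤ ℤ.+ s) (∑-ones n)

i≡-i⇒i≡0 : ∀ {i} → i ≡ ℤ.- i → i ≡ ℤ.0ℤ
i≡-i⇒i≡0 {ℤ.+ zero}   _  = refl
i≡-i⇒i≡0 {ℤ.+ suc n}  ()
i≡-i⇒i≡0 {ℤ.-[1+ n ]} ()

2*[1+m]≡2+[m+m] : ∀ m → 2 ℕ.* suc m ≡ 2 ℕ.+ (m ℕ.+ m)
2*[1+m]≡2+[m+m] = solve-∀

module FiniteFieldProperties {q : ℕ} (K : FiniteField q) where
  open FiniteField K

  commutativeRing : CommutativeRing 0ℓ 0ℓ
  commutativeRing = record { isCommutativeRing = isCommutativeRing }

  open CommutativeRing commutativeRing public
    using ( _-_; +-assoc; +-comm; +-identityˡ; +-identityʳ; -‿inverseˡ; -‿inverseʳ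
          ; *-assoc; *-comm; *-identityˡ; *-identityʳ; distribˡ; distribʳ; zeroˡ; zeroʳ
          ; +-commutativeMonoid; *-commutativeMonoid )
  open import Algebra.Properties.Ring (CommutativeRing.ring commutativeRing) public
    using (-0#≈0#; +-cancelʳ; +-inverseʳ-unique; x∙y⁻¹≈ε⇒x≈y)
  open import Algebra.Definitions.RawMonoid (CommutativeMonoid.rawMonoid +-commutativeMonoid) public
    using () renaming (_×_ to _·_)
  open import Algebra.Solver.Ring.NaturalCoefficients.Default
    (CommutativeRing.commutativeSemiring commutativeRing)

  enumeration : Fin q ↔ Carrier
  enumeration = ⤖⇒↔ card

  open Inverse enumeration public
    using (strictlyInverseˡ) renaming (to to enumerate; from to index)

  enumerate-injective : Injective _≡_ _≡_ enumerate
  enumerate-injective = Bijection.injective card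

  ∃? : {P : Carrier → Set} → (∀ x → Dec (P x)) → Dec (∃ P)
  ∃? {P} P? with Fin.any? (P? ∘ enumerate)
  ... | yes (i , Pi) = yes (enumerate i , Pi)
  ... | no  ∄i       = no λ (x , Px) → ∄i (index x , subst P (sym (strictlyInverseˡ x)) Px)

  ∀? : {P : Carrier → Set} → (∀ x → Dec (P x)) → Dec (∀ x → P x)
  ∀? {P} P? with Fin.all? (P? ∘ enumerate)
  ... | yes ∀i  = yes (λ x → subst P (strictlyInverseˡ x) (∀i (index x)))
  ... | no  ¬∀i = no (λ ∀x → ¬∀i (∀x ∘ enumerate))

  ¬∀⇒∃¬ : {P : Carrier → Set} → (∀ x → Dec (P x)) → ¬ (∀ x → P x) → ∃ λ x → ¬ P x
  ¬∀⇒∃¬ {P} P? ¬∀P with Fin.¬∀⟶∃¬ q (P ∘ enumerate) (P? ∘ enumerate) (¬∀P ∘ everywhere)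
    where
    everywhere : (∀ i → P (enumerate i)) → ∀ x → P x
    everywhere ∀i x = subst P (strictlyInverseˡ x) (∀i (index x))
  ... | i , ¬Pi = enumerate i , ¬Pi

  1≢0 : 1# ≢ 0#
  1≢0 = 0≢1 ∘ sym

  *-cancelˡ : ∀ {x y z} → x ≢ 0# → x * y ≡ x * z → y ≡ z
  *-cancelˡ {x} {y} {z} x≢0 xy≡xz with inverse x x≢0
  ... | x⁻¹ , xx⁻¹≡1 = begin
    y                  ≡⟨ sym (*-identityˡ y) ⟩
    1# * y             ≡⟨ cong (_* y) (sym xx⁻¹≡1) ⟩
    x * x⁻¹ * y        ≡⟨ solve 3 (λ x x⁻¹ y → x :* x⁻¹ :* y := x⁻¹ :* (x :* y)) refl x x⁻¹ y ⟩
    x⁻¹ * (x * y)      ≡⟨ cong (x⁻¹ *_) xy≡xz ⟩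
    x⁻¹ * (x * z)      ≡⟨ solve 3 (λ x x⁻¹ z → x⁻¹ :* (x :* z) := x :* x⁻¹ :* z) refl x x⁻¹ z ⟩
    x * x⁻¹ * z        ≡⟨ cong (_* z) xx⁻¹≡1 ⟩
    1# * z             ≡⟨ *-identityˡ z ⟩
    z                  ∎
    where open ≡-Reasoning

  zero-product : ∀ x y → x * y ≡ 0# → x ≡ 0# ⊎ y ≡ 0#
  zero-product x y xy≡0 with x ≟ 0#
  ... | yes x≡0 = inj₁ x≡0
  ... | no  x≢0 = inj₂ (*-cancelˡ x≢0 (trans xy≡0 (sym (zeroʳ x))))

  *-≢0 : ∀ {x y} → x ≢ 0# → y ≢ 0# → x * y ≢ 0#
  *-≢0 x≢0 y≢0 xy≡0 = [ x≢0 , y≢0 ] (zero-product _ _ xy≡0)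

  solve-linear : ∀ {a} → a ≢ 0# → ∀ c → ∃ λ y → a * y ≡ c
  solve-linear {a} a≢0 c with inverse a a≢0
  ... | a⁻¹ , aa⁻¹≡1 = a⁻¹ * c , trans (sym (*-assoc a a⁻¹ c)) (trans (cong (_* c) aa⁻¹≡1) (*-identityˡ c))

  idempotent⇒0∨1 : ∀ y → y * y ≡ y → y ≡ 0# ⊎ y ≡ 1#
  idempotent⇒0∨1 y yy≡y = Sum.map id (x∙y⁻¹≈ε⇒x≈y y 1#) (zero-product y (y - 1#) (begin
    y * (y - 1#)           ≡⟨ distribˡ y y (- 1#) ⟩
    y * y + y * - 1#       ≡⟨ cong (_+ y * - 1#) yy≡y ⟩
    y + y * - 1#           ≡⟨ solve 2 (λ y n → y :+ y :* n := y :* (con 1 :+ n)) refl y (- 1#) ⟩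
    y * (1# - 1#)          ≡⟨ cong (y *_) (-‿inverseʳ 1#) ⟩
    y * 0#                 ≡⟨ zeroʳ y ⟩
    0#                     ∎))
    where open ≡-Reasoning

  emb-injective : ∀ a b → emb K a ≡ emb K b → a ≡ b
  emb-injective false false _   = refl
  emb-injective false true  0≡1 = ⊥-elim (0≢1 0≡1)
  emb-injective true  false 1≡0 = ⊥-elim (1≢0 1≡0)
  emb-injective true  true  _   = refl

  emb-∧ : ∀ a b → emb K (a ∧ b) ≡ emb K a * emb K b
  emb-∧ false b = sym (zeroˡ _)
  emb-∧ true  b = sym (*-identityˡ _)

  pow-+ : ∀ x m n → pow K x (m ℕ.+ n) ≡ pow K x m * pow K x n
  pow-+ x zero    n = sym (*-identityˡ _)
  pow-+ x (suc m) n = trans (cong (x *_) (pow-+ x m n)) (sym (*-assoc _ _ _))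

  pow-2^suc : ∀ x k → pow K x (2 ^ suc k) ≡ pow K x (2 ^ k) * pow K x (2 ^ k)
  pow-2^suc x k = trans (cong (λ m → pow K x (2 ^ k ℕ.+ m)) (ℕ.+-identityʳ (2 ^ k))) (pow-+ x (2 ^ k) (2 ^ k))

  pow-0# : ∀ n → .{{ℕ.NonZero n}} → pow K 0# n ≡ 0#
  pow-0# (suc n) = zeroˡ _

  pow≡0⇒≡0 : ∀ x k → pow K x k ≡ 0# → x ≡ 0#
  pow≡0⇒≡0 x zero    1≡0   = ⊥-elim (1≢0 1≡0)
  pow≡0⇒≡0 x (suc k) xxᵏ≡0 = [ id , pow≡0⇒≡0 x k ]′ (zero-product x _ xxᵏ≡0)

  translation : Carrier → Carrier ↔ Carrier
  translation a = mk↔ₛ′ (_+ a) (_- a) (cancel (-‿inverseˡ a)) (cancel (-‿inverseʳ a))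
    where
    cancel : ∀ {u v} → u + v ≡ 0# → ∀ x → x + u + v ≡ x
    cancel {u} {v} u+v≡0 x = trans (+-assoc x u v) (trans (cong (x +_) u+v≡0) (+-identityʳ x))

  module Summation (M : CommutativeMonoid 0ℓ 0ℓ) where
    open CommutativeMonoid M using (_≈_; _∙_; ε; ∙-congˡ; identityʳ; setoid) renaming (Carrier to A)
    open import Algebra.Properties.CommutativeMonoid.Sum M public
      using (sum; sum-cong-≗; sum-cong-≋; sum-remove; sum-replicate; sum-replicate-zero; ∑-permute; ∑-distrib-+; ∑-comm)
    open import Relation.Binary.Reasoning.Setoid setoid

    sum-single : ∀ {n} (f : Fin n → A) i → (∀ j → j ≢ i → f j ≈ ε) → sum f ≈ f i
    sum-single {suc n} f i others≈ε = begin
      sum f                           ≈⟨ sum-remove f ⟩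
      f i ∙ sum (f ∘ Fin.punchIn i)   ≈⟨ ∙-congˡ (sum-cong-≋ {n} (λ j → others≈ε _ (Fin.punchInᵢ≢i i j))) ⟩
      f i ∙ sum {n} (λ _ → ε)         ≈⟨ ∙-congˡ (sum-replicate-zero n) ⟩
      f i ∙ ε                         ≈⟨ identityʳ (f i) ⟩
      f i                             ∎

    ∑K : (Carrier → A) → A
    ∑K g = sum (g ∘ enumerate)

    ∑K-reindex : (π : Carrier ↔ Carrier) (g : Carrier → A) → ∑K (g ∘ Inverse.to π) ≈ ∑K g
    ∑K-reindex π g = begin
      ∑K (g ∘ Inverse.to π)               ≡⟨ sum-cong-≗ {q} (λ i → cong g (sym (strictlyInverseˡ _))) ⟩
      sum (g ∘ enumerate ∘ Inverse.to σ)  ≈⟨ ∑-permute (g ∘ enumerate) σ ⟨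
      ∑K g                                ∎
      where
      σ : Fin q ↔ Fin q
      σ = ↔-sym enumeration ↔-∘ (π ↔-∘ enumeration)

    ∑K-single : ∀ (g : Carrier → A) x₀ → (∀ x → x ≢ x₀ → g x ≈ ε) → ∑K g ≈ g x₀
    ∑K-single g x₀ others≈ε = begin
      ∑K g                      ≈⟨ sum-single (g ∘ enumerate) (index x₀) (λ j j≢i → others≈ε _ (j≢i ∘ index-unique)) ⟩
      g (enumerate (index x₀))  ≡⟨ cong g (strictlyInverseˡ x₀) ⟩
      g x₀                      ∎
      where
      index-unique : ∀ {j} → enumerate j ≡ x₀ → j ≡ index x₀
      index-unique eq = enumerate-injective (trans eq (sym (strictlyInverseˡ x₀)))

  q·1≡0 : q · 1# ≡ 0#
  q·1≡0 = +-cancelʳ ∑x (q · 1#) 0# (begin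
    q · 1# + ∑x                ≡⟨ +-comm _ ∑x ⟩
    ∑x + q · 1#                ≡⟨ cong (∑x +_) (sym (sum-replicate q)) ⟩
    ∑x + sum {q} (λ _ → 1#)    ≡⟨ sym (∑-distrib-+ enumerate (λ _ → 1#)) ⟩
    ∑K (_+ 1#)                 ≡⟨ ∑K-reindex (translation 1#) id ⟩
    ∑x                         ≡⟨ sym (+-identityˡ ∑x) ⟩
    0# + ∑x                    ∎)
    where
    open ≡-Reasoning
    open Summation +-commutativeMonoid using (∑K; ∑K-reindex; ∑-distrib-+; sum; sum-replicate)
    ∑x : Carrier
    ∑x = ∑K id

  module Product = Summation *-commutativeMonoid

  ∏-const : ∀ n a → Product.sum {n} (λ _ → a) ≡ pow K a n
  ∏-const zero    a = refl
  ∏-const (suc n) a = cong (a *_) (∏-const n a)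

  ∏-≢0 : ∀ {n} (f : Fin n → Carrier) → (∀ i → f i ≢ 0#) → Product.sum f ≢ 0#
  ∏-≢0 {zero}  f f≢0 = 1≢0
  ∏-≢0 {suc n} f f≢0 = *-≢0 (f≢0 zero) (∏-≢0 (f ∘ suc) (f≢0 ∘ suc))

  ifZero : Carrier → Carrier → Carrier → Carrier
  ifZero x u v = if does (x ≟ 0#) then u else v

  ifZero-0# : ∀ u v → ifZero 0# u v ≡ u
  ifZero-0# u v = cong (if_then u else v) (dec-true (0# ≟ 0#) refl)

  ifZero-≢0 : ∀ {x} u v → x ≢ 0# → ifZero x u v ≡ v
  ifZero-≢0 {x} u v x≢0 = cong (if_then u else v) (dec-false (x ≟ 0#) x≢0)

  -- Reindexing by x ↦ a * x leaves ∏ unitPart unchanged, and unitPart (a * x) = a * unitPart x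
  -- except at x = 0, where correction supplies the missing a; so ∏ unitPart · a = a^q · ∏ unitPart.
  fermat-≢0 : ∀ {a} → a ≢ 0# → pow K a q ≡ a
  fermat-≢0 {a} a≢0 = sym (*-cancelˡ P≢0 (begin
    P * a
      ≡⟨ cong₂ _*_ (sym (∏K-reindex a*-permutation unitPart)) (sym ∏correction) ⟩
    ∏K (unitPart ∘ (a *_)) * ∏K correction
      ≡⟨ sym (∑-distrib-+ (unitPart ∘ (a *_) ∘ enumerate) (correction ∘ enumerate)) ⟩
    ∏K (λ x → unitPart (a * x) * correction x)
      ≡⟨ sum-cong-≗ {q} (scale ∘ enumerate) ⟩
    ∏K (λ x → a * unitPart x)
      ≡⟨ ∑-distrib-+ (λ _ → a) (unitPart ∘ enumerate) ⟩
    Product.sum {q} (λ _ → a) * P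
      ≡⟨ cong (_* P) (∏-const q a) ⟩
    pow K a q * P
      ≡⟨ *-comm _ P ⟩
    P * pow K a q
      ∎))
    where
    open ≡-Reasoning
    open Product using (∑-distrib-+; sum-cong-≗)
      renaming (∑K to ∏K; ∑K-reindex to ∏K-reindex; ∑K-single to ∏K-single)

    unitPart correction : Carrier → Carrier
    unitPart   x = ifZero x 1# x
    correction x = ifZero x a 1#

    P : Carrier
    P = ∏K unitPart

    P≢0 : P ≢ 0#
    P≢0 = ∏-≢0 (unitPart ∘ enumerate) (unitPart≢0 ∘ enumerate)
      where
      unitPart≢0 : ∀ x → unitPart x ≢ 0#
      unitPart≢0 x with x ≟ 0#
      ... | yes _   = 1≢0
      ... | no  x≢0 = x≢0

    a*-permutation : Carrier ↔ Carrier
    a*-permutation with inverse a a≢0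
    ... | a⁻¹ , aa⁻¹≡1 = mk↔ₛ′ (a *_) (a⁻¹ *_) (cancel refl) (cancel (*-comm a⁻¹ a))
      where
      cancel : ∀ {u v} → u * v ≡ a * a⁻¹ → ∀ x → u * (v * x) ≡ x
      cancel {u} {v} uv≡aa⁻¹ x =
        trans (sym (*-assoc u v x)) (trans (cong (_* x) (trans uv≡aa⁻¹ aa⁻¹≡1)) (*-identityˡ x))

    ∏correction : ∏K correction ≡ a
    ∏correction = trans (∏K-single correction 0# (λ x x≢0 → ifZero-≢0 a 1# x≢0)) (ifZero-0# a 1#)

    scale : ∀ x → unitPart (a * x) * correction x ≡ a * unitPart x
    scale x with x ≟ 0#
    ... | yes refl = begin
      unitPart (a * 0#) * a  ≡⟨ cong (λ y → unitPart y * a) (zeroʳ a) ⟩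
      unitPart 0# * a        ≡⟨ cong (_* a) (ifZero-0# 1# 0#) ⟩
      1# * a                 ≡⟨ *-comm 1# a ⟩
      a * 1#                 ∎
    ... | no x≢0 = begin
      unitPart (a * x) * 1#  ≡⟨ *-identityʳ _ ⟩
      unitPart (a * x)       ≡⟨ ifZero-≢0 1# (a * x) (*-≢0 a≢0 x≢0) ⟩
      a * x                  ∎

  fermat : ∀ a → pow K a q ≡ a
  fermat a with a ≟ 0#
  ... | yes refl = pow-0# q {{Fin.nonZeroIndex (index 0#)}}
  ... | no  a≢0  = fermat-≢0 a≢0

  module IntegerSum = Summation (Semiring.+-commutativeMonoid ℤ.+-*-semiring)

  ∑sign-additive : (φ : Carrier → Bool) → (∀ x y → φ (x + y) ≡ φ x xor φ y) →
                   ∀ {y₀} → φ y₀ ≡ true → IntegerSum.∑K (sign ∘ φ) ≡ ℤ.0ℤ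
  ∑sign-additive φ φ-additive {y₀} φy₀≡true = i≡-i⇒i≡0 (begin
    ∑K (sign ∘ φ)                 ≡⟨ sym (∑K-reindex (translation y₀) (sign ∘ φ)) ⟩
    ∑K (λ x → sign (φ (x + y₀)))  ≡⟨ sum-cong-≗ {q} (flip ∘ enumerate) ⟩
    ∑K (λ x → ℤ.- sign (φ x))     ≡⟨ ∑-neg (sign ∘ φ ∘ enumerate) ⟩
    ℤ.- ∑K (sign ∘ φ)             ∎)
    where
    open ≡-Reasoning
    open IntegerSum using (∑K; ∑K-reindex; sum-cong-≗)
    flip : ∀ x → sign (φ (x + y₀)) ≡ ℤ.- sign (φ x)
    flip x = trans (cong sign (trans (φ-additive x y₀) (cong (φ x xor_) φy₀≡true))) (sign-xor-true (φ x))

  Σ-tabulate-+ : ∀ {n} (f g : Fin n → Carrier) →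
                 Σ[_] K (tabulate (λ i → f i + g i)) ≡ Σ[_] K (tabulate f) + Σ[_] K (tabulate g)
  Σ-tabulate-+ {zero}  f g = sym (+-identityˡ 0#)
  Σ-tabulate-+ {suc n} f g = trans (cong (f zero + g zero +_) (Σ-tabulate-+ (f ∘ suc) (g ∘ suc)))
    (solve 4 (λ a b c d → (a :+ b) :+ (c :+ d) := (a :+ c) :+ (b :+ d)) refl (f zero) (g zero) _ _)

  Σ-tabulate-shift : ∀ n (f : ℕ → Carrier) →
                     Σ[_] K (tabulate {n = n} (λ k → f (suc (toℕ k)))) + f 0
                       ≡ Σ[_] K (tabulate {n = n} (λ k → f (toℕ k))) + f n
  Σ-tabulate-shift zero    f = refl
  Σ-tabulate-shift (suc n) f = begin
    f 1 + Σ₂ + f 0          ≡⟨ solve 3 (λ a b c → a :+ b :+ c := c :+ (b :+ a)) refl (f 1) Σ₂ (f 0) ⟩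
    f 0 + (Σ₂ + f 1)        ≡⟨ cong (f 0 +_) (Σ-tabulate-shift n (f ∘ suc)) ⟩
    f 0 + (Σ₁ + f (suc n))  ≡⟨ sym (+-assoc _ _ _) ⟩
    f 0 + Σ₁ + f (suc n)    ∎
    where
    open ≡-Reasoning
    Σ₁ Σ₂ : Carrier
    Σ₁ = Σ[_] K (tabulate {n = n} (λ k → f (suc (toℕ k))))
    Σ₂ = Σ[_] K (tabulate {n = n} (λ k → f (suc (suc (toℕ k)))))

  -- f is pointwise a polynomial function of exact degree d, presented in Horner form.
  data HasDegree : ℕ → (Carrier → Carrier) → Set where
    constant : ∀ {c f} → c ≢ 0# → (∀ x → f x ≡ c) → HasDegree 0 f
    horner   : ∀ {d f} b g → HasDegree d g → (∀ x → f x ≡ b + x * g x) → HasDegree (suc d) f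

  HasDegree-resp : ∀ {d f g} → HasDegree d f → f ≗ g → HasDegree d g
  HasDegree-resp (constant c≢0 f≡c)  f≗g = constant c≢0 (λ x → trans (sym (f≗g x)) (f≡c x))
  HasDegree-resp (horner b h deg eq) f≗g = horner b h deg (λ x → trans (sym (f≗g x)) (eq x))

  pow-hasDegree : ∀ m → HasDegree m (λ x → pow K x m)
  pow-hasDegree zero    = constant 1≢0 (λ _ → refl)
  pow-hasDegree (suc m) = horner 0# _ (pow-hasDegree m) (λ _ → sym (+-identityˡ _))

  +-hasDegree : ∀ {d e f g} → HasDegree d f → HasDegree e g → e < d → HasDegree d (λ x → g x + f x)
  +-hasDegree (horner b f′ deg eq) (constant {c} _ g≡c) _ =
    horner (c + b) f′ deg (λ x → trans (cong₂ _+_ (g≡c x) (eq x)) (sym (+-assoc c b _)))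
  +-hasDegree (horner b f′ deg eq) (horner b′ g′ deg′ eq′) (s≤s e<d) =
    horner (b′ + b) (λ x → g′ x + f′ x) (+-hasDegree deg deg′ e<d) λ x →
      trans (cong₂ _+_ (eq′ x) (eq x))
        (solve 5 (λ b′ x g b f → (b′ :+ x :* g) :+ (b :+ x :* f) := (b′ :+ b) :+ x :* (g :+ f))
          refl b′ x (g′ x) b (f′ x))

  ∑pow-hasDegree : (e : ℕ → ℕ) → (∀ k → e k < e (suc k)) → ∀ n →
                   HasDegree (e n) (λ x → Σ[_] K (tabulate {n = suc n} (λ k → pow K x (e (toℕ k)))))
  ∑pow-hasDegree e e-increasing zero    = HasDegree-resp (pow-hasDegree (e 0)) (λ x → sym (+-identityʳ _))
  ∑pow-hasDegree e e-increasing (suc n) =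
    +-hasDegree (∑pow-hasDegree (e ∘ suc) (e-increasing ∘ suc) n) (pow-hasDegree (e 0)) (e₀<e n)
    where
    e₀<e : ∀ n → e 0 < e (suc n)
    e₀<e zero    = e-increasing 0
    e₀<e (suc n) = ℕ.<-trans (e₀<e n) (e-increasing (suc n))

  horner-shift : ∀ a b x y → (x - a) * y + (b + a * y) ≡ b + x * y
  horner-shift a b x y = begin
    (x - a) * y + (b + a * y)  ≡⟨ solve 5 (λ a n b x y → (x :+ n) :* y :+ (b :+ a :* y) := b :+ x :* y :+ (a :+ n) :* y)
                                     refl a (- a) b x y ⟩
    b + x * y + (a - a) * y    ≡⟨ cong (λ z → b + x * y + z * y) (-‿inverseʳ a) ⟩
    b + x * y + 0# * y         ≡⟨ cong (b + x * y +_) (zeroˡ y) ⟩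
    b + x * y + 0#             ≡⟨ +-identityʳ _ ⟩
    b + x * y                  ∎
    where open ≡-Reasoning

  factor-theorem : ∀ {d f} → HasDegree (suc d) f → ∀ a →
                   ∃ λ h → HasDegree d h × (∀ x → f x ≡ (x - a) * h x + f a)
  factor-theorem {f = f} (horner b g deg@(constant _ g≡c) eq) a = g , deg , λ x → begin
    f x                            ≡⟨ eq x ⟩
    b + x * g x                    ≡⟨ sym (horner-shift a b x (g x)) ⟩
    (x - a) * g x + (b + a * g x)  ≡⟨ cong (λ z → (x - a) * g x + (b + a * z)) (trans (g≡c x) (sym (g≡c a))) ⟩
    (x - a) * g x + (b + a * g a)  ≡⟨ cong ((x - a) * g x +_) (sym (eq a)) ⟩
    (x - a) * g x + f a            ∎
    where open ≡-Reasoning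
  factor-theorem {f = f} (horner b g deg@(horner _ _ _ _) eq) a with factor-theorem deg a
  ... | h , deg-h , g≡ = (λ x → x * h x + g a) , horner (g a) h deg-h (λ x → +-comm _ _) , λ x → begin
    f x                                                  ≡⟨ eq x ⟩
    b + x * g x                                          ≡⟨ cong (λ z → b + x * z) (g≡ x) ⟩
    b + x * ((x - a) * h x + g a)                        ≡⟨ solve 5 (λ b x n h c → b :+ x :* ((x :+ n) :* h :+ c)
                                                                                := b :+ x :* c :+ x :* ((x :+ n) :* h))
                                                              refl b x (- a) (h x) (g a) ⟩
    b + x * g a + x * ((x - a) * h x)                    ≡⟨ cong (_+ x * ((x - a) * h x)) (sym (horner-shift a b x (g a))) ⟩
    (x - a) * g a + (b + a * g a) + x * ((x - a) * h x)  ≡⟨ solve 5 (λ x n c b′ h → (x :+ n) :* c :+ b′ :+ x :* ((x :+ n) :* h)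
                                                                                 := (x :+ n) :* (x :* h :+ c) :+ b′)
                                                              refl x (- a) (g a) (b + a * g a) (h x) ⟩
    (x - a) * (x * h x + g a) + (b + a * g a)            ≡⟨ cong ((x - a) * (x * h x + g a) +_) (sym (eq a)) ⟩
    (x - a) * (x * h x + g a) + f a                      ∎
    where open ≡-Reasoning

  roots≤degree : ∀ {d f m} → HasDegree d f → (e : Fin m → Carrier) → Injective _≡_ _≡_ e →
                 (∀ i → f (e i) ≡ 0#) → m ≤ d
  roots≤degree {m = zero}  _                  _ _ _     = z≤n
  roots≤degree {m = suc m} (constant c≢0 f≡c) e _ roots = ⊥-elim (c≢0 (trans (sym (f≡c (e zero))) (roots zero)))
  roots≤degree {f = f} {m = suc m} deg@(horner _ _ _ _) e e-injective roots with factor-theorem deg (e zero)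
  ... | h , deg-h , f≡ = s≤s (roots≤degree deg-h (e ∘ suc) (Fin.suc-injective ∘ e-injective) h-roots)
    where
    h-roots : ∀ i → h (e (suc i)) ≡ 0#
    h-roots i with zero-product (e (suc i) - e zero) (h (e (suc i))) product≡0
      where
      product≡0 : (e (suc i) - e zero) * h (e (suc i)) ≡ 0#
      product≡0 = +-cancelʳ (f (e zero)) _ _
        (trans (sym (f≡ (e (suc i)))) (trans (roots (suc i)) (trans (sym (roots zero)) (sym (+-identityˡ _)))))
    ... | inj₁ eᵢ-e₀≡0 = ⊥-elim (Fin.0≢1+n (sym (e-injective (x∙y⁻¹≈ε⇒x≈y _ _ eᵢ-e₀≡0))))
    ... | inj₂ h≡0     = h≡0

  HasDegree⇒nonvanishing : ∀ {d f} → HasDegree d f → d < q → ¬ (∀ x → f x ≡ 0#)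
  HasDegree⇒nonvanishing deg d<q f≡0 = ℕ.<⇒≱ d<q (roots≤degree deg enumerate enumerate-injective (f≡0 ∘ enumerate))

  zeros : ∀ {n} → Vec Carrier n
  zeros = replicate _ 0#

  identity : ∀ n → Matrix K n
  identity zero    = []
  identity (suc n) = (1# ∷ zeros) ∷ map (0# ∷_) (identity n)

  minor : ∀ {k n} → Vec (Vec Carrier (suc n)) k → Fin (suc n) → Vec (Vec Carrier n) k
  minor rows j = map (λ row → removeAt row j) rows

  Σ-zero : ∀ {n} (f : Fin n → Carrier) → (∀ i → f i ≡ 0#) → Σ[_] K (tabulate f) ≡ 0#
  Σ-zero {zero}  f f≡0 = refl
  Σ-zero {suc n} f f≡0 = trans (cong₂ _+_ (f≡0 zero) (Σ-zero (f ∘ suc) (f≡0 ∘ suc))) (+-identityʳ 0#)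

  signed-0* : ∀ k x → signed K k (0# * x) ≡ 0#
  signed-0* zero    x = zeroˡ x
  signed-0* (suc k) x = trans (cong -_ (signed-0* k x)) -0#≈0#

  laplace-zeros : ∀ {n} (k : Fin n → ℕ) (minorDet : Fin n → Carrier) →
                  Σ[_] K (tabulate (λ j → signed K (k j) (lookup zeros j * minorDet j))) ≡ 0#
  laplace-zeros k minorDet = Σ-zero _ λ j →
    trans (cong (λ z → signed K (k j) (z * minorDet j)) (Vec.lookup-replicate j 0#)) (signed-0* (k j) (minorDet j))

  det-zeroRow : ∀ n rows → det K (suc n) (zeros ∷ rows) ≡ 0#
  det-zeroRow n rows = laplace-zeros toℕ (det K n ∘ minor rows)

  det-expand₀ : ∀ n a rows → det K (suc n) ((a ∷ zeros) ∷ rows) ≡ a * det K n (minor rows zero)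
  det-expand₀ n a rows = trans
    (cong (a * det K n (minor rows zero) +_) (laplace-zeros (λ j → suc (toℕ j)) (λ j → det K n (minor rows (suc j)))))
    (+-identityʳ _)

  det-identity : ∀ n → det K n (identity n) ≡ 1#
  det-identity zero    = refl
  det-identity (suc n) = begin
    det K (suc n) (identity (suc n))                      ≡⟨ det-expand₀ n 1# _ ⟩
    1# * det K n (minor (map (0# ∷_) (identity n)) zero)  ≡⟨ cong (λ m → 1# * det K n m) minor≡identity ⟩
    1# * det K n (identity n)                             ≡⟨ *-identityˡ _ ⟩
    det K n (identity n)                                  ≡⟨ det-identity n ⟩
    1#                                                    ∎
    where
    open ≡-Reasoning
    minor≡identity : minor (map (0# ∷_) (identity n)) zero ≡ identity n
    minor≡identity = trans (sym (Vec.map-∘ _ _ (identity n))) (Vec.map-id (identity n))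

  Tr-identity : ∀ n → Tr K (identity n) ≡ n · 1#
  Tr-identity zero    = refl
  Tr-identity (suc n) = cong (1# +_) (trans (cong (Σ[_] K) (Vec.tabulate-cong diagonal)) (Tr-identity n))
    where
    diagonal : ∀ i → lookup (lookup (map (0# ∷_) (identity n)) i) (suc i) ≡ lookup (lookup (identity n) i) i
    diagonal i = cong (λ row → lookup row (suc i)) (Vec.lookup-map i (0# ∷_) (identity n))

  traceMatrix : Carrier → ∀ m → Matrix K (2 ℕ.+ m)
  traceMatrix t m = (t ∷ 1# ∷ zeros) ∷ (1# ∷ 0# ∷ zeros) ∷ map (λ row → 0# ∷ 0# ∷ row) (identity m)

  det-traceMatrix : ∀ t m → det K (2 ℕ.+ m) (traceMatrix t m) ≡ - 1#
  det-traceMatrix t m = begin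
    t * det K (suc m) (zeros ∷ minor padded zero) + (- (1# * det K (suc m) ((1# ∷ zeros) ∷ minor padded (suc zero))) + rest)
        ≡⟨ cong₂ (λ u v → t * u + (- (1# * v) + rest))
                 (trans (cong (λ M → det K (suc m) (zeros ∷ M)) minor₀) (det-zeroRow m _))
                 (trans (cong (λ M → det K (suc m) ((1# ∷ zeros) ∷ M)) minor₁) (det-identity (suc m))) ⟩
    t * 0# + (- (1# * 1#) + rest)
        ≡⟨ cong₂ (λ u v → u + (- (1# * 1#) + v)) (zeroʳ t)
                 (laplace-zeros (λ j → suc (suc (toℕ j))) (λ j → det K (suc m) (minor rows (suc (suc j))))) ⟩
    0# + (- (1# * 1#) + 0#)
        ≡⟨ trans (+-identityˡ _) (trans (+-identityʳ _) (cong -_ (*-identityˡ 1#))) ⟩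
    - 1#  ∎
    where
    open ≡-Reasoning
    padded : Vec (Vec Carrier (2 ℕ.+ m)) m
    padded = map (λ row → 0# ∷ 0# ∷ row) (identity m)
    rows : Vec (Vec Carrier (2 ℕ.+ m)) (suc m)
    rows = (1# ∷ 0# ∷ zeros) ∷ padded
    minor₀ : minor padded zero ≡ map (0# ∷_) (identity m)
    minor₀ = sym (Vec.map-∘ _ _ (identity m))
    minor₁ : minor padded (suc zero) ≡ map (0# ∷_) (identity m)
    minor₁ = sym (Vec.map-∘ _ _ (identity m))
    rest : Carrier
    rest = Σ[_] K (tabulate λ j → signed K (suc (suc (toℕ j))) (lookup zeros j * det K (suc m) (minor rows (suc (suc j)))))

  Tr-traceMatrix : ∀ t m → Tr K (traceMatrix t m) ≡ t + m · 1#
  Tr-traceMatrix t m =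
    cong (t +_) (trans (+-identityˡ _) (trans (cong (Σ[_] K) (Vec.tabulate-cong diagonal)) (Tr-identity m)))
    where
    diagonal : ∀ i → lookup (lookup (map (λ row → 0# ∷ 0# ∷ row) (identity m)) i) (suc (suc i))
                   ≡ lookup (lookup (identity m) i) i
    diagonal i = cong (λ row → lookup row (suc (suc i))) (Vec.lookup-map i (λ row → 0# ∷ 0# ∷ row) (identity m))

module Characteristic2 {q : ℕ} (K : FiniteField q)
  (1+1≡0 : FiniteField._+_ K (FiniteField.1# K) (FiniteField.1# K) ≡ FiniteField.0# K) where
  open FiniteField K
  open FiniteFieldProperties K
  open import Algebra.Properties.Monoid.Mult (CommutativeMonoid.monoid +-commutativeMonoid) using (×-homo-+)
  open import Algebra.Solver.Ring.NaturalCoefficients.Default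
    (CommutativeRing.commutativeSemiring commutativeRing)

  x+x≡0 : ∀ x → x + x ≡ 0#
  x+x≡0 x = begin
    x + x          ≡⟨ solve 1 (λ x → x :+ x := (con 1 :+ con 1) :* x) refl x ⟩
    (1# + 1#) * x  ≡⟨ cong (_* x) 1+1≡0 ⟩
    0# * x         ≡⟨ zeroˡ x ⟩
    0#             ∎
    where open ≡-Reasoning

  -x≡x : ∀ x → - x ≡ x
  -x≡x x = sym (+-inverseʳ-unique x x (x+x≡0 x))

  x+y≡0⇒x≡y : ∀ {x y} → x + y ≡ 0# → x ≡ y
  x+y≡0⇒x≡y {x} {y} x+y≡0 = x∙y⁻¹≈ε⇒x≈y x y (trans (cong (x +_) (-x≡x y)) x+y≡0)

  emb-xor : ∀ a b → emb K (a xor b) ≡ emb K a + emb K b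
  emb-xor false b     = sym (+-identityˡ _)
  emb-xor true  false = sym (+-identityʳ _)
  emb-xor true  true  = sym 1+1≡0

  +-square : ∀ x y → (x + y) * (x + y) ≡ x * x + y * y
  +-square x y = begin
    (x + y) * (x + y)                ≡⟨ solve 2 (λ x y → (x :+ y) :* (x :+ y) := x :* x :+ y :* y :+ (x :* y :+ x :* y))
                                             refl x y ⟩
    x * x + y * y + (x * y + x * y)  ≡⟨ cong (x * x + y * y +_) (x+x≡0 (x * y)) ⟩
    x * x + y * y + 0#               ≡⟨ +-identityʳ _ ⟩
    x * x + y * y                    ∎
    where open ≡-Reasoning

  frobenius-+ : ∀ k x y → pow K (x + y) (2 ^ k) ≡ pow K x (2 ^ k) + pow K y (2 ^ k)
  frobenius-+ zero    x y = trans (*-identityʳ _) (sym (cong₂ _+_ (*-identityʳ x) (*-identityʳ y)))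
  frobenius-+ (suc k) x y = begin
    pow K (x + y) (2 ^ suc k)                    ≡⟨ pow-2^suc (x + y) k ⟩
    pow K (x + y) (2 ^ k) * pow K (x + y) (2 ^ k) ≡⟨ cong (λ z → z * z) (frobenius-+ k x y) ⟩
    (xᵏ + yᵏ) * (xᵏ + yᵏ)                        ≡⟨ +-square xᵏ yᵏ ⟩
    xᵏ * xᵏ + yᵏ * yᵏ                            ≡⟨ sym (cong₂ _+_ (pow-2^suc x k) (pow-2^suc y k)) ⟩
    pow K x (2 ^ suc k) + pow K y (2 ^ suc k)    ∎
    where
    open ≡-Reasoning
    xᵏ yᵏ : Carrier
    xᵏ = pow K x (2 ^ k)
    yᵏ = pow K y (2 ^ k)

  Σ-tabulate-square : ∀ {n} (f : Fin n → Carrier) →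
                      Σ[_] K (tabulate f) * Σ[_] K (tabulate f) ≡ Σ[_] K (tabulate (λ i → f i * f i))
  Σ-tabulate-square {zero}  f = zeroˡ 0#
  Σ-tabulate-square {suc n} f =
    trans (+-square (f zero) _) (cong (f zero * f zero +_) (Σ-tabulate-square (f ∘ suc)))

  even·1≡0 : ∀ m → (m ℕ.+ m) · 1# ≡ 0#
  even·1≡0 m = trans (×-homo-+ 1# m m) (x+x≡0 (m · 1#))

  SL-trace-surjective : ∀ m t → ∃ λ (g : Matrix K (2 ℕ.+ (m ℕ.+ m))) → IsSL K (2 ℕ.+ (m ℕ.+ m)) g × Tr K g ≡ t
  SL-trace-surjective m t =
      traceMatrix t (m ℕ.+ m)
    , trans (det-traceMatrix t (m ℕ.+ m)) (-x≡x 1#)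
    , trans (Tr-traceMatrix t (m ℕ.+ m)) (trans (cong (t +_) (even·1≡0 m)) (+-identityʳ t))

  SL-trace-surjective-2^ : ∀ s → 1 ≤ s → ∀ t → ∃ λ (g : Matrix K (2 ^ s)) → IsSL K (2 ^ s) g × Tr K g ≡ t
  SL-trace-surjective-2^ (suc s) _ =
    subst (λ n → ∀ t → ∃ λ (g : Matrix K n) → IsSL K n g × Tr K g ≡ t) (sym 2^[1+s]≡2+[m+m]) (SL-trace-surjective m)
    where
    m : ℕ
    m = ℕ.pred (2 ^ s)
    2^[1+s]≡2+[m+m] : 2 ^ suc s ≡ 2 ℕ.+ (m ℕ.+ m)
    2^[1+s]≡2+[m+m] = trans (cong (2 ℕ.*_) (sym (ℕ.suc-pred (2 ^ s) {{ℕ.m^n≢0 2 s}}))) (2*[1+m]≡2+[m+m] m)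

module AbsoluteTrace (r : ℕ) (K : FiniteField (2 ^ r)) where
  open FiniteField K
  open FiniteFieldProperties K
  open import Algebra.Properties.Semiring.Mult (CommutativeRing.semiring commutativeRing) using (×1-homo-*)
  open import Algebra.Properties.Semiring.Sum ℤ.+-*-semiring using (*-distribˡ-sum)
  open IntegerSum using (∑K; ∑K-single; sum-cong-≗; ∑-comm)

  2^k·1≡[1+1]^k : ∀ k → (2 ^ k) · 1# ≡ pow K (1# + 1#) k
  2^k·1≡[1+1]^k zero    = +-identityʳ 1#
  2^k·1≡[1+1]^k (suc k) = begin
    (2 ℕ.* 2 ^ k) · 1#             ≡⟨ ×1-homo-* 2 (2 ^ k) ⟩
    (2 · 1#) * ((2 ^ k) · 1#)      ≡⟨ cong₂ _*_ (cong (1# +_) (+-identityʳ 1#)) (2^k·1≡[1+1]^k k) ⟩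
    (1# + 1#) * pow K (1# + 1#) k  ∎
    where open ≡-Reasoning

  characteristic2 : 1# + 1# ≡ 0#
  characteristic2 = pow≡0⇒≡0 (1# + 1#) r (trans (sym (2^k·1≡[1+1]^k r)) q·1≡0)

  open Characteristic2 K characteristic2

  tr : Carrier → Carrier
  tr = trK K r

  tr₂ : Carrier → Bool
  tr₂ = trB K r

  tr-+ : ∀ x y → tr (x + y) ≡ tr x + tr y
  tr-+ x y = trans (cong (Σ[_] K) (Vec.tabulate-cong {n = r} (λ k → frobenius-+ (toℕ k) x y)))
                   (Σ-tabulate-+ {r} (λ k → pow K x (2 ^ toℕ k)) (λ k → pow K y (2 ^ toℕ k)))

  tr-0 : tr 0# ≡ 0#
  tr-0 = +-cancelʳ (tr 0#) (tr 0#) 0#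
    (trans (sym (tr-+ 0# 0#)) (trans (cong tr (+-identityˡ 0#)) (sym (+-identityˡ _))))

  -- Squaring shifts the exponents: (tr x)² + x = tr x + x^q, and x^q = x.
  tr-idempotent : ∀ x → tr x * tr x ≡ tr x
  tr-idempotent x = +-cancelʳ x (tr x * tr x) (tr x) (begin
    tr x * tr x + x
      ≡⟨ cong₂ _+_ (Σ-tabulate-square {r} (λ k → x^2^ (toℕ k))) (sym (*-identityʳ x)) ⟩
    Σ[_] K (tabulate {n = r} (λ k → x^2^ (toℕ k) * x^2^ (toℕ k))) + x^2^ 0
      ≡⟨ cong (λ v → Σ[_] K v + x^2^ 0) (Vec.tabulate-cong {n = r} (λ k → sym (pow-2^suc x (toℕ k)))) ⟩
    Σ[_] K (tabulate {n = r} (λ k → x^2^ (suc (toℕ k)))) + x^2^ 0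
      ≡⟨ Σ-tabulate-shift r x^2^_ ⟩
    tr x + pow K x (2 ^ r)
      ≡⟨ cong (tr x +_) (fermat x) ⟩
    tr x + x
      ∎)
    where
    open ≡-Reasoning
    x^2^_ : ℕ → Carrier
    x^2^ k = pow K x (2 ^ k)

  tr-0∨1 : ∀ x → tr x ≡ 0# ⊎ tr x ≡ 1#
  tr-0∨1 x = idempotent⇒0∨1 (tr x) (tr-idempotent x)

  emb-tr₂ : ∀ x → emb K (tr₂ x) ≡ tr x
  emb-tr₂ x with tr x ≟ 1# | tr-0∨1 x
  ... | yes tr≡1 | _         = sym tr≡1
  ... | no  _    | inj₁ tr≡0 = sym tr≡0
  ... | no  tr≢1 | inj₂ tr≡1 = ⊥-elim (tr≢1 tr≡1)

  tr₂-+ : ∀ x y → tr₂ (x + y) ≡ tr₂ x xor tr₂ y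
  tr₂-+ x y = emb-injective _ _ (begin
    emb K (tr₂ (x + y))            ≡⟨ emb-tr₂ (x + y) ⟩
    tr (x + y)                     ≡⟨ tr-+ x y ⟩
    tr x + tr y                    ≡⟨ sym (cong₂ _+_ (emb-tr₂ x) (emb-tr₂ y)) ⟩
    emb K (tr₂ x) + emb K (tr₂ y)  ≡⟨ sym (emb-xor (tr₂ x) (tr₂ y)) ⟩
    emb K (tr₂ x xor tr₂ y)        ∎)
    where open ≡-Reasoning

  tr₂-linear : ∀ x a b → tr₂ ((a + b) * x) ≡ tr₂ (a * x) xor tr₂ (b * x)
  tr₂-linear x a b = trans (cong tr₂ (distribʳ x a b)) (tr₂-+ _ _)

  tr₂-0 : tr₂ 0# ≡ false
  tr₂-0 = emb-injective _ _ (trans (emb-tr₂ 0#) tr-0)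

  tr₂-1 : ∀ {c} → tr c ≡ 1# → tr₂ c ≡ true
  tr₂-1 {c} trc≡1 = emb-injective _ _ (trans (emb-tr₂ c) trc≡1)

  tr-hasDegree : ∀ {r′} → r ≡ suc r′ → HasDegree (2 ^ r′) tr
  tr-hasDegree {r′} r≡1+r′ = subst (λ n → HasDegree (2 ^ r′) (trK K n)) (sym r≡1+r′)
    (∑pow-hasDegree (2 ^_) (λ k → ℕ.^-monoʳ-< 2 (s≤s (s≤s z≤n)) (ℕ.n<1+n k)) r′)

  tr≢0 : 1 ≤ r → ¬ (∀ x → tr x ≡ 0#)
  tr≢0 1≤r = HasDegree⇒nonvanishing (tr-hasDegree r≡1+r′) degree<q
    where
    r≡1+r′ : r ≡ suc (ℕ.pred r)
    r≡1+r′ = sym (ℕ.suc-pred r {{ℕ.>-nonZero 1≤r}})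
    degree<q : 2 ^ ℕ.pred r < 2 ^ r
    degree<q = subst (λ n → 2 ^ ℕ.pred r < 2 ^ n) (sym r≡1+r′)
                     (ℕ.^-monoʳ-< 2 (s≤s (s≤s z≤n)) (ℕ.n<1+n (ℕ.pred r)))

  tr-hits-1 : 1 ≤ r → ∃ λ c → tr c ≡ 1#
  tr-hits-1 1≤r with ¬∀⇒∃¬ {λ x → tr x ≡ 0#} (λ x → tr x ≟ 0#) (tr≢0 1≤r)
  ... | c , trc≢0 = c , [ (λ trc≡0 → ⊥-elim (trc≢0 trc≡0)) , id ]′ (tr-0∨1 c)

  tr₂-hits-true : 1 ≤ r → ∀ {x} → x ≢ 0# → ∃ λ a → tr₂ (a * x) ≡ true
  tr₂-hits-true 1≤r {x} x≢0 with tr-hits-1 1≤r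
  ... | c , trc≡1 with solve-linear x≢0 c
  ...   | y , xy≡c = y , tr₂-1 (trans (cong tr (trans (*-comm y x) xy≡c)) trc≡1)

  tr₂-nondegenerate : 1 ≤ r → ∀ {a} → (∀ x → tr₂ (a * x) ≡ false) → a ≡ 0#
  tr₂-nondegenerate 1≤r {a} vanishes with a ≟ 0#
  ... | yes a≡0 = a≡0
  ... | no  a≢0 with tr₂-hits-true 1≤r a≢0
  ...   | y , tr₂ya≡true with () ← trans (sym tr₂ya≡true) (trans (cong tr₂ (*-comm y a)) (vanishes y))

  ∑sign-tr₂-0 : ∑K (λ a → sign (tr₂ (a * 0#))) ≡ ℤ.+ (2 ^ r)
  ∑sign-tr₂-0 = trans (sum-cong-≗ {2 ^ r} (λ i → cong sign (trans (cong tr₂ (zeroʳ _)) tr₂-0))) (∑-ones (2 ^ r))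

  ∑sign-tr₂-≢0 : 1 ≤ r → ∀ {x} → x ≢ 0# → ∑K (λ a → sign (tr₂ (a * x))) ≡ ℤ.0ℤ
  ∑sign-tr₂-≢0 1≤r {x} x≢0 =
    ∑sign-additive (λ a → tr₂ (a * x)) (tr₂-linear x) (proj₂ (tr₂-hits-true 1≤r x≢0))

  -- If f differed from every x ↦ tr₂ (a * x), each correlation of f with these q characters
  -- would vanish, while by orthogonality of the characters the correlations add up to q.
  module TraceForm (1≤r : 1 ≤ r) (f : Carrier → Bool) (f-additive : ∀ x y → f (x + y) ≡ f x xor f y) where
    correlation : Carrier → ℤ
    correlation a = ∑K (λ x → sign (f x) ℤ.* sign (tr₂ (a * x)))

    correlation-mismatch : ∀ a {x₀} → f x₀ ≢ tr₂ (a * x₀) → correlation a ≡ ℤ.0ℤ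
    correlation-mismatch a mismatch = trans
      (sum-cong-≗ {2 ^ r} (λ i → sym (sign-xor (f (enumerate i)) (tr₂ (a * enumerate i)))))
      (∑sign-additive (λ x → f x xor tr₂ (a * x)) difference-additive (≢⇒xor≡true mismatch))
      where
      difference-additive : ∀ x y → f (x + y) xor tr₂ (a * (x + y)) ≡ (f x xor tr₂ (a * x)) xor (f y xor tr₂ (a * y))
      difference-additive x y =
        trans (cong₂ _xor_ (f-additive x y) (trans (cong tr₂ (distribˡ a x y)) (tr₂-+ _ _)))
              (xor-interchange (f x) (f y) _ _)

    f-0 : f 0# ≡ false
    f-0 = trans (cong f (sym (+-identityˡ 0#))) (trans (f-additive 0# 0#) (Bool.xor-same (f 0#)))

    ∑correlation : ∑K correlation ≡ ℤ.+ (2 ^ r)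
    ∑correlation = begin
      ∑K correlation
        ≡⟨ ∑-comm (λ i j → sign (f (enumerate j)) ℤ.* sign (tr₂ (enumerate i * enumerate j))) ⟩
      ∑K (λ x → ∑K (λ a → sign (f x) ℤ.* sign (tr₂ (a * x))))
        ≡⟨ sum-cong-≗ {2 ^ r} (pull-out ∘ enumerate) ⟩
      ∑K (λ x → sign (f x) ℤ.* ∑K (λ a → sign (tr₂ (a * x))))
        ≡⟨ ∑K-single _ 0# vanishes-off-0 ⟩
      sign (f 0#) ℤ.* ∑K (λ a → sign (tr₂ (a * 0#)))
        ≡⟨ cong₂ ℤ._*_ (cong sign f-0) ∑sign-tr₂-0 ⟩
      ℤ.1ℤ ℤ.* ℤ.+ (2 ^ r)
        ≡⟨ ℤ.*-identityˡ _ ⟩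
      ℤ.+ (2 ^ r)
        ∎
      where
      open ≡-Reasoning
      pull-out : ∀ x → ∑K (λ a → sign (f x) ℤ.* sign (tr₂ (a * x))) ≡ sign (f x) ℤ.* ∑K (λ a → sign (tr₂ (a * x)))
      pull-out x = sym (*-distribˡ-sum (sign (f x)) (λ i → sign (tr₂ (enumerate i * x))))
      vanishes-off-0 : ∀ x → x ≢ 0# → sign (f x) ℤ.* ∑K (λ a → sign (tr₂ (a * x))) ≡ ℤ.0ℤ
      vanishes-off-0 x x≢0 = trans (cong (sign (f x) ℤ.*_) (∑sign-tr₂-≢0 1≤r x≢0)) (ℤ.*-zeroʳ (sign (f x)))

    trace-form : ∃ λ a → ∀ x → f x ≡ tr₂ (a * x)
    trace-form with ∃? (λ a → ∀? (λ x → f x Bool.≟ tr₂ (a * x)))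
    ... | yes found = found
    ... | no  none  = ⊥-elim (q≢0 (ℤ.+-injective (trans (sym ∑correlation) ∑correlation≡0)))
      where
      q≢0 : 2 ^ r ≢ 0
      q≢0 = ℕ.≢-nonZero⁻¹ (2 ^ r) {{ℕ.m^n≢0 2 r}}
      mismatch : ∀ a → correlation a ≡ ℤ.0ℤ
      mismatch a =
        correlation-mismatch a (proj₂ (¬∀⇒∃¬ (λ x → f x Bool.≟ tr₂ (a * x)) (λ all → none (a , all))))
      ∑correlation≡0 : ∑K correlation ≡ ℤ.0ℤ
      ∑correlation≡0 = trans (sum-cong-≗ {2 ^ r} (mismatch ∘ enumerate)) (ℤSum.sum-replicate-zero (2 ^ r))

module TraceCode (r : ℕ) (K : FiniteField (2 ^ r)) where
  open FiniteField K
  open FiniteFieldProperties K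
  open AbsoluteTrace r K
  open Characteristic2 K characteristic2
  open import Algebra.Solver.Ring.NaturalCoefficients.Default
    (CommutativeRing.commutativeSemiring commutativeRing)

  unitVec : ∀ {N} → Fin N → Vec Bool N
  unitVec zero    = true ∷ replicate _ false
  unitVec (suc i) = false ∷ unitVec i

  units : ∀ {N k} → Vec (Fin N) k → Vec Bool N
  units []       = replicate _ false
  units (i ∷ is) = zipWith _xor_ (unitVec i) (units is)

  traceSum : ∀ {n N} → Vec Bool N → Vec (Matrix K n) N → Carrier
  traceSum u gs = Σ[_] K (zipWith (λ uᵢ g → emb K uᵢ * Tr K g) u gs)

  dot₂-xor : ∀ {N} (u v w : Vec Bool N) → dot₂ K (zipWith _xor_ u v) w ≡ dot₂ K u w xor dot₂ K v w
  dot₂-xor []       []       []       = refl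
  dot₂-xor (u ∷ us) (v ∷ vs) (w ∷ ws) =
    trans (cong₂ _xor_ (Bool.∧-distribʳ-xor w u v) (dot₂-xor us vs ws)) (xor-interchange (u ∧ w) (v ∧ w) _ _)

  dot₂-falses : ∀ {N} (w : Vec Bool N) → dot₂ K (replicate N false) w ≡ false
  dot₂-falses []       = refl
  dot₂-falses (_ ∷ ws) = dot₂-falses ws

  dot₂-unitVec : ∀ {N} (i : Fin N) w → dot₂ K (unitVec i) w ≡ lookup w i
  dot₂-unitVec zero    (w ∷ ws) = trans (cong (w xor_) (dot₂-falses ws)) (Bool.xor-identityʳ w)
  dot₂-unitVec (suc i) (_ ∷ ws) = dot₂-unitVec i ws

  dot₂-units : ∀ {N k} (is : Vec (Fin N) k) w → dot₂ K (units is) w ≡ Vec.foldr′ _xor_ false (map (lookup w) is)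
  dot₂-units []       w = dot₂-falses w
  dot₂-units (i ∷ is) w =
    trans (dot₂-xor (unitVec i) (units is) w) (cong₂ _xor_ (dot₂-unitVec i w) (dot₂-units is w))

  traceSum-falses : ∀ {n N} (gs : Vec (Matrix K n) N) → traceSum (replicate N false) gs ≡ 0#
  traceSum-falses []       = refl
  traceSum-falses (g ∷ gs) = trans (cong₂ _+_ (zeroˡ _) (traceSum-falses gs)) (+-identityˡ 0#)

  traceSum-unitVec : ∀ {n N} (i : Fin N) (gs : Vec (Matrix K n) N) → traceSum (unitVec i) gs ≡ Tr K (lookup gs i)
  traceSum-unitVec zero    (g ∷ gs) = trans (cong₂ _+_ (*-identityˡ _) (traceSum-falses gs)) (+-identityʳ _)
  traceSum-unitVec (suc i) (g ∷ gs) = trans (cong₂ _+_ (zeroˡ _) (traceSum-unitVec i gs)) (+-identityˡ _)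

  traceSum-xor : ∀ {n N} (u v : Vec Bool N) (gs : Vec (Matrix K n) N) →
                 traceSum (zipWith _xor_ u v) gs ≡ traceSum u gs + traceSum v gs
  traceSum-xor []       []       []       = sym (+-identityˡ 0#)
  traceSum-xor (u ∷ us) (v ∷ vs) (g ∷ gs) =
    trans (cong₂ _+_ (cong (_* Tr K g) (emb-xor u v)) (traceSum-xor us vs gs))
          (solve 5 (λ a b t x y → (a :+ b) :* t :+ (x :+ y) := (a :* t :+ x) :+ (b :* t :+ y))
                 refl (emb K u) (emb K v) (Tr K g) _ _)

  traceSum-units : ∀ {n N k} (gs : Vec (Matrix K n) N) (is : Vec (Fin N) k) →
                   traceSum (units is) gs ≡ Σ[_] K (map (λ i → Tr K (lookup gs i)) is)
  traceSum-units gs []       = traceSum-falses gs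
  traceSum-units gs (i ∷ is) =
    trans (traceSum-xor (unitVec i) (units is) gs) (cong₂ _+_ (traceSum-unitVec i gs) (traceSum-units gs is))

  emb-dot₂-cw : ∀ {n N} a (u : Vec Bool N) (gs : Vec (Matrix K n) N) →
                emb K (dot₂ K u (cw K r gs a)) ≡ tr (a * traceSum u gs)
  emb-dot₂-cw a []       []       = sym (trans (cong tr (zeroʳ a)) tr-0)
  emb-dot₂-cw a (u ∷ us) (g ∷ gs) = begin
    emb K ((u ∧ tr₂ (a * Tr K g)) xor dot₂ K us (cw K r gs a))
      ≡⟨ emb-xor (u ∧ tr₂ (a * Tr K g)) (dot₂ K us (cw K r gs a)) ⟩
    emb K (u ∧ tr₂ (a * Tr K g)) + emb K (dot₂ K us (cw K r gs a))
      ≡⟨ cong₂ _+_ (trans (emb-∧ u _) (cong (emb K u *_) (emb-tr₂ _))) (emb-dot₂-cw a us gs) ⟩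
    emb K u * tr (a * Tr K g) + tr (a * traceSum us gs)
      ≡⟨ cong (_+ tr (a * traceSum us gs)) (sym (tr-emb-* u _)) ⟩
    tr (emb K u * (a * Tr K g)) + tr (a * traceSum us gs)
      ≡⟨ sym (tr-+ _ _) ⟩
    tr (emb K u * (a * Tr K g) + a * traceSum us gs)
      ≡⟨ cong tr (solve 4 (λ e a t s → e :* (a :* t) :+ a :* s := a :* (e :* t :+ s)) refl (emb K u) a (Tr K g) _) ⟩
    tr (a * (emb K u * Tr K g + traceSum us gs))
      ∎
    where
    open ≡-Reasoning
    tr-emb-* : ∀ b y → tr (emb K b * y) ≡ emb K b * tr y
    tr-emb-* false y = trans (cong tr (zeroˡ y)) (trans tr-0 (sym (zeroˡ _)))
    tr-emb-* true  y = trans (cong tr (*-identityˡ y)) (sym (*-identityˡ _))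

  cw∈C⊥ : ∀ {n N} (gs : Vec (Matrix K n) N) a → InC⊥ K gs (cw K r gs a)
  cw∈C⊥ gs a u u∈C = emb-injective _ _
    (trans (emb-dot₂-cw a u gs) (trans (cong (λ s → tr (a * s)) u∈C) (trans (cong tr (zeroʳ a)) tr-0)))

  cw-+ : ∀ {n N} (gs : Vec (Matrix K n) N) a b → cw K r gs (a + b) ≡ zipWith _xor_ (cw K r gs a) (cw K r gs b)
  cw-+ []       a b = refl
  cw-+ (g ∷ gs) a b = cong₂ _∷_ (tr₂-linear (Tr K g) a b) (cw-+ gs a b)

  C⊥-relation : ∀ {n N k} (gs : Vec (Matrix K n) N) {w} → InC⊥ K gs w → (is : Vec (Fin N) k) →
                Σ[_] K (map (λ i → Tr K (lookup gs i)) is) ≡ 0# → Vec.foldr′ _xor_ false (map (lookup w) is) ≡ false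
  C⊥-relation gs {w} w∈C⊥ is traces≡0 =
    trans (sym (dot₂-units is w)) (w∈C⊥ (units is) (trans (traceSum-units gs is) traces≡0))

  module _ (1≤r : 1 ≤ r) {n N} (gs : Vec (Matrix K n) N) (index-of : ∀ t → ∃ λ i → Tr K (lookup gs i) ≡ t) where
    position : Carrier → Fin N
    position t = proj₁ (index-of t)

    Tr-position : ∀ t → Tr K (lookup gs (position t)) ≡ t
    Tr-position t = proj₂ (index-of t)

    lookup-cw : ∀ a i → lookup (cw K r gs a) i ≡ tr₂ (a * Tr K (lookup gs i))
    lookup-cw a i = Vec.lookup-map i _ gs

    lookup-cw-position : ∀ a x → lookup (cw K r gs a) (position x) ≡ tr₂ (a * x)
    lookup-cw-position a x = trans (lookup-cw a (position x)) (cong (λ t → tr₂ (a * t)) (Tr-position x))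

    cw-injective : Injective _≡_ _≡_ (cw K r gs)
    cw-injective {a} {b} cwa≡cwb = x+y≡0⇒x≡y (tr₂-nondegenerate 1≤r vanishes)
      where
      vanishes : ∀ x → tr₂ ((a + b) * x) ≡ false
      vanishes x = begin
        tr₂ ((a + b) * x)            ≡⟨ tr₂-linear x a b ⟩
        tr₂ (a * x) xor tr₂ (b * x)  ≡⟨ cong (_xor tr₂ (b * x)) agree ⟩
        tr₂ (b * x) xor tr₂ (b * x)  ≡⟨ Bool.xor-same (tr₂ (b * x)) ⟩
        false                        ∎
        where
        open ≡-Reasoning
        agree : tr₂ (a * x) ≡ tr₂ (b * x)
        agree = trans (sym (lookup-cw-position a x))
                      (trans (cong (λ v → lookup v (position x)) cwa≡cwb) (lookup-cw-position b x))

    module _ (w : Vec Bool N) (w∈C⊥ : InC⊥ K gs w) where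
      valueAt : Carrier → Bool
      valueAt t = lookup w (position t)

      w≡valueAt-Tr : ∀ i → lookup w i ≡ valueAt (Tr K (lookup gs i))
      w≡valueAt-Tr i = xor≡false⇒≡ (trans (cong (lookup w i xor_) (sym (Bool.xor-identityʳ _)))
                                        (C⊥-relation gs w∈C⊥ (i ∷ position t ∷ []) traces≡0))
        where
        t : Carrier
        t = Tr K (lookup gs i)
        traces≡0 : t + (Tr K (lookup gs (position t)) + 0#) ≡ 0#
        traces≡0 = trans (cong (t +_) (trans (+-identityʳ _) (Tr-position t))) (x+x≡0 t)

      valueAt-+ : ∀ x y → valueAt (x + y) ≡ valueAt x xor valueAt y
      valueAt-+ x y = sym (xor≡false⇒≡ (begin
        (valueAt x xor valueAt y) xor valueAt (x + y)
          ≡⟨ Bool.xor-assoc (valueAt x) (valueAt y) _ ⟩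
        valueAt x xor (valueAt y xor valueAt (x + y))
          ≡⟨ cong (λ b → valueAt x xor (valueAt y xor b)) (sym (Bool.xor-identityʳ _)) ⟩
        valueAt x xor (valueAt y xor (valueAt (x + y) xor false))
          ≡⟨ C⊥-relation gs w∈C⊥ (position x ∷ position y ∷ position (x + y) ∷ []) traces≡0 ⟩
        false
          ∎))
        where
        open ≡-Reasoning
        Tr[_] : Carrier → Carrier
        Tr[ t ] = Tr K (lookup gs (position t))
        traces≡0 : Tr[ x ] + (Tr[ y ] + (Tr[ x + y ] + 0#)) ≡ 0#
        traces≡0 = begin
          Tr[ x ] + (Tr[ y ] + (Tr[ x + y ] + 0#))
            ≡⟨ cong₂ (λ u v → u + (v + (Tr[ x + y ] + 0#))) (Tr-position x) (Tr-position y) ⟩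
          x + (y + (Tr[ x + y ] + 0#))
            ≡⟨ cong (λ z → x + (y + z)) (trans (+-identityʳ _) (Tr-position (x + y))) ⟩
          x + (y + (x + y))
            ≡⟨ solve 2 (λ x y → x :+ (y :+ (x :+ y)) := (x :+ y) :+ (x :+ y)) refl x y ⟩
          (x + y) + (x + y)
            ≡⟨ x+x≡0 (x + y) ⟩
          0#
            ∎

      cw-surjective : ∃ λ a → cw K r gs a ≡ w
      cw-surjective with TraceForm.trace-form 1≤r valueAt valueAt-+
      ... | a , valueAt≡tr₂ =
        a , trans (sym (Vec.tabulate∘lookup _)) (trans (Vec.tabulate-cong agree) (Vec.tabulate∘lookup w))
        where
        agree : ∀ i → lookup (cw K r gs a) i ≡ lookup w i
        agree i = trans (lookup-cw a i) (sym (trans (w≡valueAt-Tr i) (valueAt≡tr₂ _)))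

-- Only the fact that every element of K occurs as a trace Tr(g_i) is used.
proposition7 :
    (s r : ℕ) → 1 ≤ s → 1 ≤ r → (K : FiniteField (2 ^ r)) →
    (N : ℕ) → (gs : Vec (Matrix K (2 ^ s)) N) →
    (∀ i → IsSL K (2 ^ s) (lookup gs i)) →
    (∀ g → IsSL K (2 ^ s) g → ∃ λ i → lookup gs i ≡ g) →
    (∀ i j → lookup gs i ≡ lookup gs j → i ≡ j) →
    ((∀ a → InC⊥ K gs (cw K r gs a))
      × (∀ a b → cw K r gs (FiniteField._+_ K a b) ≡ zipWith _xor_ (cw K r gs a) (cw K r gs b))
      × Injective _≡_ _≡_ (cw K r gs)
      × (∀ w → InC⊥ K gs w → ∃ λ a → cw K r gs a ≡ w))
proposition7 s r 1≤s 1≤r K N gs _ SL⊆gs _ =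
  cw∈C⊥ gs , cw-+ gs , cw-injective 1≤r gs index-of , cw-surjective 1≤r gs index-of
  where
  open TraceCode r K
  open Characteristic2 K (AbsoluteTrace.characteristic2 r K) using (SL-trace-surjective-2^)
  index-of : ∀ t → ∃ λ i → Tr K (lookup gs i) ≡ t
  index-of t with SL-trace-surjective-2^ s 1≤s t
  ... | g , g∈SL , Trg≡t with SL⊆gs g g∈SL
  ...   | i , gᵢ≡g = i , trans (cong (Tr K) gᵢ≡g) Trg≡t
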